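{- Let $\lambda$ be an odd positive integer and $k$ a positive integer with $k\not\equiv 1\pmod 4$. Then no $k$-MOFS$(2\lambda)$ satisfies a full relation.
   Context: Let $N(n)=\{1,\dots,n\}$ and let $n$ be even. A (binary) frequency square of order $n$ is an $n\times n$ array indexed by $N(n)\times N(n)$ with entries in $\{0,1\}$ such that every row and every column contains exactly $n/2$ zeros and $n/2$ ones. Two frequency squares $F,G$ of order $n$ are orthogonal if for each $(a,b)\in\{0,1\}^2$ the number of cells $(r,c)$ with $(F[r,c],G[r,c])=(a,b)$ equals $n^2/4$. A $k$-MOFS$(n)$ is an ordered set $F_1,\dots,F_k$ of pairwise orthogonal frequency squares of order $n$. Relations: form the $n^2\times(k+2)$ array $\mathcal O$ having a row $(i,j,F_1[i,j],\dots,F_k[i,j])$ for each $(i,j)\in N(n)^2$. Let $Y_1=Y_2=N(n)$ and $Y_c=\{0,1\}$ for $3\le c\le k+2$. A relation is a tuple $(X_1,\dots,X_{k+2})$ with $X_c\subseteq Y_c$ for all $c$ such that every row of $\mathcal O$ has an even number of positions $c$ for which the $c$-th entry of the row lies in $X_c$. A relation is trivial on column $c$ if $X_c=\emptyset$ or $X_c=Y_c$; it is full if it is non-trivial on every column $c\in\{1,\dots,k+2\}$ except possibly one of the columns $1,2$. -}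

module Defs where

open import Data.Nat using (ℕ; zero; suc; _+_; _*_; _%_)
open import Data.Fin using (Fin; zero; suc)
open import Data.Bool using (Bool; true; false; not; _∧_; if_then_else_)
open import Data.Product using (_×_; ∃; Σ)
open import Data.Sum using (_⊎_)
open import Relation.Binary.PropositionalEquality using (_≡_; _≢_)

-- Entries {0,1} are represented by Bool, with false = 0 and true = 1.
-- N(n) is represented by Fin n.

⟦_⟧ : Bool → ℕ
⟦ true ⟧ = 1
⟦ false ⟧ = 0

count : ∀ {n} → (Fin n → Bool) → ℕ
count {zero} P = 0
count {suc n} P = ⟦ P zero ⟧ + count (λ i → P (suc i))

sumFin : ∀ {n} → (Fin n → ℕ) → ℕ
sumFin {zero} f = 0
sumFin {suc n} f = f zero + sumFin (λ i → f (suc i))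

_==_ : Bool → Bool → Bool
true == b = b
false == b = not b

Square : ℕ → Set
Square n = Fin n → Fin n → Bool

countCells : ∀ {n} → (Fin n → Fin n → Bool) → ℕ
countCells P = sumFin (λ r → count (λ c → P r c))

IsFrequencySquare : (h : ℕ) → Square (2 * h) → Set
IsFrequencySquare h F =
  (∀ r → count (λ c → F r c == false) ≡ h × count (λ c → F r c == true) ≡ h) ×
  (∀ c → count (λ r → F r c == false) ≡ h × count (λ r → F r c == true) ≡ h)

Orthogonal : (h : ℕ) → Square (2 * h) → Square (2 * h) → Set
Orthogonal h F G =
  ∀ a b → countCells (λ r c → (F r c == a) ∧ (G r c == b)) ≡ h * h

IsMOFS : (h k : ℕ) → (Fin k → Square (2 * h)) → Set
IsMOFS h k F =
  (∀ m → IsFrequencySquare h (F m)) ×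
  (∀ m m' → m ≢ m' → Orthogonal h (F m) (F m'))

-- A relation (X_1, X_2, X_3, ..., X_{k+2}): X₁, X₂ ⊆ N(n) and
-- X m ⊆ {0,1} for the column of square F_m (m : Fin k), all as
-- characteristic functions.
record Relation (n k : ℕ) : Set where
  constructor relation
  field
    X₁ : Fin n → Bool
    X₂ : Fin n → Bool
    X  : Fin k → Bool → Bool

-- number of positions of row (i,j,F_1[i,j],...,F_k[i,j]) of O whose entry
-- lies in the corresponding X_c
hits : ∀ {n k} → (Fin k → Square n) → Relation n k → Fin n → Fin n → ℕ
hits F R i j =
  ⟦ Relation.X₁ R i ⟧ + ⟦ Relation.X₂ R j ⟧ + sumFin (λ m → ⟦ Relation.X R m (F m i j) ⟧)

Satisfies : ∀ {n k} → (Fin k → Square n) → Relation n k → Set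
Satisfies F R = ∀ i j → hits F R i j % 2 ≡ 0

NonTrivial : {Y : Set} → (Y → Bool) → Set
NonTrivial {Y} P = ∃ (λ (y : Y) → P y ≡ true) × ∃ (λ (y : Y) → P y ≡ false)

Full : ∀ {n k} → Relation n k → Set
Full R =
  (∀ m → NonTrivial (Relation.X R m)) ×
  (NonTrivial (Relation.X₁ R) ⊎ NonTrivial (Relation.X₂ R))

-- In a full relation every X_c with c ≥ 3 is a non-trivial subset of {0, 1}, i.e. a singleton
-- {c_m}, so the number of hits in cell (i, j) is h = [i ∈ X₁] + [j ∈ X₂] + #{m | F_m[i, j] = c_m}.
-- Row and column sums of the squares and orthogonality of each pair determine the first two
-- moments of h over all cells, which gives Σ (h² + 6h) as a polynomial in A = |X₁|, B = |X₂|, k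
-- and λ.  Every h is even, so h² + 6h = h (h + 6) is divisible by 8, and so is the polynomial.
-- Complementing both X₁ and X₃ preserves the parity of every row of the orthogonal array, so the
-- same holds with A replaced by 2λ − A; a row and a column sum of the hits give
-- A ≡ B ≡ kλ (mod 2).  For odd λ and k ≢ 1 (mod 4) these congruences have no common solution.
module Submission where

open import Defs
open import Data.Nat using (ℕ; _*_; _%_; _<_)
open import Data.Fin using (Fin)
open import Data.Product using (Σ; _×_)
open import Relation.Binary.PropositionalEquality using (_≡_; _≢_)
open import Relation.Nullary using (¬_; Dec; contradiction)

open import Data.Bool using (Bool; true; false; not; _∧_)
open import Data.Fin using (zero; suc)
open import Data.Fin.Properties using (suc-injective)
open import Data.Nat using (zero; suc; _+_; NonZero)
open import Data.Nat.DivMod using (m%n%n≡m%n; %-distribˡ-+; %-distribˡ-*; m%n<n; m∣n⇒o%n%m≡o%m; [m+kn]%n≡m%n)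
open import Data.Nat.Divisibility
  using (_∣_; _∣?_; divides; _∣0; ∣-refl; ∣-trans; m∣m*n; ∣m∣n⇒∣m+n; ∣m+n∣m⇒∣n; m%n≡0⇒n∣m; n∣m⇒m%n≡0)
open import Data.Nat.Properties
  using (_≟_; allUpTo?; +-assoc; +-comm; +-suc; +-identityʳ; *-zeroʳ; *-distribˡ-+; *-comm; +-commutativeSemigroup)
open import Algebra.Properties.CommutativeSemigroup +-commutativeSemigroup using (interchange; xy∙z≈y∙xz)
open import Data.Nat.Tactic.RingSolver using (solve-∀)
open import Data.Product using (_,_; proj₁; proj₂)
open import Function using (_∘_)
open import Relation.Binary.PropositionalEquality using (refl; sym; trans; cong; cong₂; subst; module ≡-Reasoning)
open import Relation.Nullary.Decidable using (_×-dec_; _→-dec_; ¬?; from-yes; map′)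

open ≡-Reasoning

sumFin-cong : ∀ {n} {f g : Fin n → ℕ} → (∀ i → f i ≡ g i) → sumFin f ≡ sumFin g
sumFin-cong {zero}  f≡g = refl
sumFin-cong {suc n} f≡g = cong₂ _+_ (f≡g zero) (sumFin-cong (λ i → f≡g (suc i)))

sumFin-+ : ∀ {n} (f g : Fin n → ℕ) → sumFin (λ i → f i + g i) ≡ sumFin f + sumFin g
sumFin-+ {zero}  f g = refl
sumFin-+ {suc n} f g = begin
  f zero + g zero + sumFin (λ i → f (suc i) + g (suc i))
    ≡⟨ cong (f zero + g zero +_) (sumFin-+ (λ i → f (suc i)) (λ i → g (suc i))) ⟩
  f zero + g zero + (sumFin (λ i → f (suc i)) + sumFin (λ i → g (suc i)))
    ≡⟨ interchange (f zero) (g zero) _ _ ⟩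
  sumFin f + sumFin g ∎

sumFin-*ˡ : ∀ {n} a (f : Fin n → ℕ) → sumFin (λ i → a * f i) ≡ a * sumFin f
sumFin-*ˡ {zero}  a f = sym (*-zeroʳ a)
sumFin-*ˡ {suc n} a f =
  trans (cong (a * f zero +_) (sumFin-*ˡ a (λ i → f (suc i)))) (sym (*-distribˡ-+ a (f zero) _))

sumFin-*ʳ : ∀ {n} a (f : Fin n → ℕ) → sumFin (λ i → f i * a) ≡ sumFin f * a
sumFin-*ʳ a f = trans (sumFin-cong (λ i → *-comm (f i) a)) (trans (sumFin-*ˡ a f) (*-comm a _))

sumFin-const : ∀ {n} {f : Fin n → ℕ} a → (∀ i → f i ≡ a) → sumFin f ≡ n * a
sumFin-const {zero}  a f≡a = refl
sumFin-const {suc n} a f≡a = cong₂ _+_ (f≡a zero) (sumFin-const a (λ i → f≡a (suc i)))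

sumFin-const-except : ∀ {n} (m : Fin n) {g : Fin n → ℕ} {a b} →
  (∀ m′ → m ≢ m′ → g m′ ≡ a) → g m ≡ a + b → sumFin g ≡ n * a + b
sumFin-const-except {suc n} zero {g} {a} {b} g≡a gm≡a+b = begin
  g zero + sumFin (λ i → g (suc i)) ≡⟨ cong₂ _+_ gm≡a+b (sumFin-const a (λ i → g≡a (suc i) (λ ()))) ⟩
  a + b + n * a                     ≡⟨ xy∙z≈y∙xz a b (n * a) ⟩
  b + (a + n * a)                   ≡⟨ +-comm b (a + n * a) ⟩
  a + n * a + b                     ∎
sumFin-const-except {suc n} (suc m) {g} {a} g≡a gm≡a+b =
  trans (cong₂ _+_ (g≡a zero (λ ()))
                   (sumFin-const-except m (λ m′ m≢m′ → g≡a (suc m′) (m≢m′ ∘ suc-injective)) gm≡a+b))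
        (sym (+-assoc a (n * a) _))

sumFin-swap : ∀ {m n} (f : Fin m → Fin n → ℕ) →
  sumFin (λ i → sumFin (f i)) ≡ sumFin (λ j → sumFin (λ i → f i j))
sumFin-swap {zero}  {n} f = sym (trans (sumFin-const {n} 0 (λ _ → refl)) (*-zeroʳ n))
sumFin-swap {suc m} f =
  trans (cong (sumFin (f zero) +_) (sumFin-swap (λ i → f (suc i))))
        (sym (sumFin-+ (f zero) (λ j → sumFin (λ i → f (suc i) j))))

sumFin-∣ : ∀ {d n} {f : Fin n → ℕ} → (∀ i → d ∣ f i) → d ∣ sumFin f
sumFin-∣ {d} {zero}  d∣f = d ∣0
sumFin-∣ {d} {suc n} d∣f = ∣m∣n⇒∣m+n (d∣f zero) (sumFin-∣ (λ i → d∣f (suc i)))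

count≡sumFin : ∀ {n} (P : Fin n → Bool) → count P ≡ sumFin (λ i → ⟦ P i ⟧)
count≡sumFin {zero}  P = refl
count≡sumFin {suc n} P = cong (⟦ P zero ⟧ +_) (count≡sumFin (λ i → P (suc i)))

sumFin-weighted : ∀ {n} (x : Fin n → Bool) {s : Fin n → ℕ} {r} →
  (∀ i → s i ≡ r) → sumFin (λ i → ⟦ x i ⟧ * s i) ≡ count x * r
sumFin-weighted x {s} {r} s≡r = begin
  sumFin (λ i → ⟦ x i ⟧ * s i) ≡⟨ sumFin-cong (λ i → cong (⟦ x i ⟧ *_) (s≡r i)) ⟩
  sumFin (λ i → ⟦ x i ⟧ * r)   ≡⟨ sumFin-*ʳ r (λ i → ⟦ x i ⟧) ⟩
  sumFin (λ i → ⟦ x i ⟧) * r   ≡⟨ cong (_* r) (count≡sumFin x) ⟨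
  count x * r                  ∎

sumFin-*-sumFin : ∀ {m n} (f : Fin m → ℕ) (g : Fin n → ℕ) →
  sumFin f * sumFin g ≡ sumFin (λ i → sumFin (λ j → f i * g j))
sumFin-*-sumFin f g =
  trans (sym (sumFin-*ʳ (sumFin g) f)) (sumFin-cong (λ i → sym (sumFin-*ˡ (f i) g)))

count+count-not : ∀ {n} (P : Fin n → Bool) → count P + count (λ i → not (P i)) ≡ n
count+count-not {zero}  P = refl
count+count-not {suc n} P with P zero | count+count-not (λ i → P (suc i))
... | true  | eq = cong suc eq
... | false | eq = trans (+-suc (count (λ i → P (suc i))) _) (cong suc eq)

module CellSums (m n : ℕ) where

  sumCells : (Fin m → Fin n → ℕ) → ℕ
  sumCells f = sumFin (λ i → sumFin (f i))

  sumCells-cong : ∀ {f g} → (∀ i j → f i j ≡ g i j) → sumCells f ≡ sumCells g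
  sumCells-cong f≡g = sumFin-cong (λ i → sumFin-cong (f≡g i))

  sumCells-+-≡ : ∀ {f g a b} → sumCells f ≡ a → sumCells g ≡ b → sumCells (λ i j → f i j + g i j) ≡ a + b
  sumCells-+-≡ {f} {g} Σf≡a Σg≡b =
    trans (sumFin-cong (λ i → sumFin-+ (f i) (g i)))
          (trans (sumFin-+ (λ i → sumFin (f i)) (λ i → sumFin (g i))) (cong₂ _+_ Σf≡a Σg≡b))

  sumCells-*-≡ : ∀ {f a} c → sumCells f ≡ a → sumCells (λ i j → c * f i j) ≡ c * a
  sumCells-*-≡ {f} c Σf≡a =
    trans (sumFin-cong (λ i → sumFin-*ˡ c (f i))) (trans (sumFin-*ˡ c (λ i → sumFin (f i))) (cong (c *_) Σf≡a))

  sumCells-sumFin-comm : ∀ {p} (f : Fin m → Fin n → Fin p → ℕ) →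
    sumCells (λ i j → sumFin (f i j)) ≡ sumFin (λ q → sumCells (λ i j → f i j q))
  sumCells-sumFin-comm f =
    trans (sumFin-cong (λ i → sumFin-swap (f i))) (sumFin-swap (λ i q → sumFin (λ j → f i j q)))

  sumCells-rowWeighted : ∀ (x : Fin m → Bool) {g : Fin m → Fin n → ℕ} {r} →
    (∀ i → sumFin (g i) ≡ r) → sumCells (λ i j → ⟦ x i ⟧ * g i j) ≡ count x * r
  sumCells-rowWeighted x {g} rows =
    trans (sumFin-cong (λ i → sumFin-*ˡ ⟦ x i ⟧ (g i))) (sumFin-weighted x rows)

  sumCells-colWeighted : ∀ (y : Fin n → Bool) {g : Fin m → Fin n → ℕ} {r} →
    (∀ j → sumFin (λ i → g i j) ≡ r) → sumCells (λ i j → ⟦ y j ⟧ * g i j) ≡ count y * r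
  sumCells-colWeighted y {g} cols =
    trans (sumFin-swap (λ i j → ⟦ y j ⟧ * g i j))
          (trans (sumFin-cong (λ j → sumFin-*ˡ ⟦ y j ⟧ (λ i → g i j))) (sumFin-weighted y cols))

countCells≡sumCells : ∀ {n} (P : Fin n → Fin n → Bool) → countCells P ≡ CellSums.sumCells n n (λ i j → ⟦ P i j ⟧)
countCells≡sumCells P = sumFin-cong (λ i → count≡sumFin (P i))

module Congruence (d : ℕ) .{{_ : NonZero d}} where

  infix 4 _≈_ _≈?_
  record _≈_ (m n : ℕ) : Set where
    constructor %-≡
    field ≈⇒%-≡ : m % d ≡ n % d
  open _≈_

  ≈-refl : ∀ {m} → m ≈ m
  ≈-refl = %-≡ refl

  ≈-sym : ∀ {m n} → m ≈ n → n ≈ m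
  ≈-sym (%-≡ eq) = %-≡ (sym eq)

  ≈-trans : ∀ {m n o} → m ≈ n → n ≈ o → m ≈ o
  ≈-trans (%-≡ eq) (%-≡ eq′) = %-≡ (trans eq eq′)

  ≡⇒≈ : ∀ {m n} → m ≡ n → m ≈ n
  ≡⇒≈ eq = %-≡ (cong (_% d) eq)

  %-≈ : ∀ m → m % d ≈ m
  %-≈ m = %-≡ (m%n%n≡m%n m d)

  +-≈ : ∀ {m m′ n n′} → m ≈ m′ → n ≈ n′ → m + n ≈ m′ + n′
  +-≈ {m} {m′} {n} {n′} (%-≡ m≈m′) (%-≡ n≈n′) = %-≡ (begin
    (m + n) % d           ≡⟨ %-distribˡ-+ m n d ⟩
    (m % d + n % d) % d   ≡⟨ cong₂ (λ a b → (a + b) % d) m≈m′ n≈n′ ⟩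
    (m′ % d + n′ % d) % d ≡⟨ %-distribˡ-+ m′ n′ d ⟨
    (m′ + n′) % d         ∎)

  *-≈ : ∀ {m m′ n n′} → m ≈ m′ → n ≈ n′ → m * n ≈ m′ * n′
  *-≈ {m} {m′} {n} {n′} (%-≡ m≈m′) (%-≡ n≈n′) = %-≡ (begin
    (m * n) % d             ≡⟨ %-distribˡ-* m n d ⟩
    (m % d * (n % d)) % d   ≡⟨ cong₂ (λ a b → (a * b) % d) m≈m′ n≈n′ ⟩
    (m′ % d * (n′ % d)) % d ≡⟨ %-distribˡ-* m′ n′ d ⟨
    (m′ * n′) % d           ∎)

  ∣-resp-≈ : ∀ {e m n} .{{_ : NonZero e}} → e ∣ d → m ≈ n → e ∣ m → e ∣ n
  ∣-resp-≈ {e} {m} {n} e∣d (%-≡ m≈n) e∣m = m%n≡0⇒n∣m n e (begin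
    n % e     ≡⟨ m∣n⇒o%n%m≡o%m e d n e∣d ⟨
    n % d % e ≡⟨ cong (_% e) m≈n ⟨
    m % d % e ≡⟨ m∣n⇒o%n%m≡o%m e d m e∣d ⟩
    m % e     ≡⟨ n∣m⇒m%n≡0 m e e∣m ⟩
    0         ∎)

  _≈?_ : ∀ m n → Dec (m ≈ n)
  m ≈? n = map′ %-≡ ≈⇒%-≡ (m % d ≟ n % d)

open Congruence 8

2∣n⇒8∣n*n+6*n : ∀ {n} → 2 ∣ n → 8 ∣ n * n + 6 * n
2∣n⇒8∣n*n+6*n {n} 2∣n =
  ∣-resp-≈ ∣-refl (+-≈ (*-≈ r≈n r≈n) (*-≈ (≈-refl {6}) r≈n))
    (residue (m%n<n n 8) (∣-resp-≈ (divides 4 refl) (≈-sym r≈n) 2∣n))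
  where
  r≈n : n % 8 ≈ n
  r≈n = %-≈ n
  residue : ∀ {r} → r < 8 → 2 ∣ r → 8 ∣ r * r + 6 * r
  residue = from-yes (allUpTo? (λ r → 2 ∣? r →-dec 8 ∣? r * r + 6 * r) 8)

hitMoment : ℕ → ℕ → ℕ → ℕ → ℕ
hitMoment A B k l = 2 * l * (k + 7) * (A + B) + 2 * (A * B) + k * (k + 13) * (l * l)

hitMoment-% : ∀ A B k l → hitMoment (A % 8) (B % 8) (k % 8) (l % 8) ≈ hitMoment A B k l
hitMoment-% A B k l =
  +-≈ (+-≈ (*-≈ (*-≈ (*-≈ (≈-refl {2}) (%-≈ l)) (+-≈ (%-≈ k) (≈-refl {7}))) (+-≈ (%-≈ A) (%-≈ B)))
           (*-≈ (≈-refl {2}) (*-≈ (%-≈ A) (%-≈ B))))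
      (*-≈ (*-≈ (%-≈ k) (+-≈ (%-≈ k) (≈-refl {13}))) (*-≈ (%-≈ l) (%-≈ l)))

HitConditions : ℕ → ℕ → ℕ → ℕ → ℕ → Set
HitConditions A A′ B k l =
  l % 2 ≡ 1 × k % 4 ≢ 1 × 2 ∣ A + k * l × 2 ∣ B + k * l × A + A′ ≈ 2 * l ×
  8 ∣ hitMoment A B k l × 8 ∣ hitMoment A′ B k l

HitConditions-residues : ∀ A A′ B k l → HitConditions A A′ B k l →
  HitConditions (A % 8) (A′ % 8) (B % 8) (k % 8) (l % 8)
HitConditions-residues A A′ B k l (l-odd , k≢1 , 2∣A+kl , 2∣B+kl , A+A′≈2l , 8∣P , 8∣P′) =
  trans (m∣n⇒o%n%m≡o%m 2 8 l (divides 4 refl)) l-odd ,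
  k≢1 ∘ trans (sym (m∣n⇒o%n%m≡o%m 4 8 k (divides 2 refl))) ,
  ∣-resp-≈ (divides 4 refl) (≈-sym (+-≈ (%-≈ A) (*-≈ (%-≈ k) (%-≈ l)))) 2∣A+kl ,
  ∣-resp-≈ (divides 4 refl) (≈-sym (+-≈ (%-≈ B) (*-≈ (%-≈ k) (%-≈ l)))) 2∣B+kl ,
  ≈-trans (+-≈ (%-≈ A) (%-≈ A′)) (≈-trans A+A′≈2l (≈-sym (*-≈ (≈-refl {2}) (%-≈ l)))) ,
  ∣-resp-≈ ∣-refl (≈-sym (hitMoment-% A B k l)) 8∣P ,
  ∣-resp-≈ ∣-refl (≈-sym (hitMoment-% A′ B k l)) 8∣P′

-- The residue check replaces a case split on k.  If k is even, then A and B are even, A − l is odd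
-- and, as A′ ≡ 2l − A, hitMoment A B k l − hitMoment A′ B k l ≡ 4 (A − l) (l (k + 7) + B) ≡ 4
-- (mod 8).  If k ≡ 3 (mod 4), then A and B are odd and hitMoment A B k l ≡ 2 A B ≡ 2 (mod 4).
¬HitConditions : ∀ A A′ B k l → ¬ HitConditions A A′ B k l
¬HitConditions A A′ B k l conditions =
  noResidues (m%n<n A 8) (m%n<n A′ 8) (m%n<n B 8) (m%n<n k 8) (m%n<n l 8)
    (HitConditions-residues A A′ B k l conditions)
  where
  hitConditions? : ∀ A A′ B k l → Dec (HitConditions A A′ B k l)
  hitConditions? A A′ B k l =
    l % 2 ≟ 1 ×-dec ¬? (k % 4 ≟ 1) ×-dec 2 ∣? A + k * l ×-dec 2 ∣? B + k * l ×-dec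
    A + A′ ≈? 2 * l ×-dec 8 ∣? hitMoment A B k l ×-dec 8 ∣? hitMoment A′ B k l
  noResidues : ∀ {A} → A < 8 → ∀ {A′} → A′ < 8 → ∀ {B} → B < 8 → ∀ {k} → k < 8 → ∀ {l} → l < 8 →
    ¬ HitConditions A A′ B k l
  noResidues = from-yes
    (allUpTo? (λ A → allUpTo? (λ A′ → allUpTo? (λ B → allUpTo? (λ k → allUpTo? (λ l →
      ¬? (hitConditions? A A′ B k l)) 8) 8) 8) 8) 8)

⟦⟧-idem : ∀ b → ⟦ b ⟧ * ⟦ b ⟧ ≡ ⟦ b ⟧
⟦⟧-idem true  = refl
⟦⟧-idem false = refl

⟦⟧-∧ : ∀ a b → ⟦ a ⟧ * ⟦ b ⟧ ≡ ⟦ a ∧ b ⟧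
⟦⟧-∧ true  b = +-identityʳ ⟦ b ⟧
⟦⟧-∧ false b = refl

hit-square : ∀ u w s → let h = ⟦ u ⟧ + ⟦ w ⟧ + s in
  h * h + 6 * h ≡ 7 * ⟦ u ⟧ + 7 * ⟦ w ⟧ + 2 * (⟦ u ⟧ * ⟦ w ⟧) + 2 * (⟦ u ⟧ * s) + 2 * (⟦ w ⟧ * s) + s * s + 6 * s
hit-square true  true  = solve-∀
hit-square true  false = solve-∀
hit-square false true  = solve-∀
hit-square false false = solve-∀

frequencySquare-row : ∀ {h F} → IsFrequencySquare h F → ∀ r b → count (λ c → F r c == b) ≡ h
frequencySquare-row freq r true  = proj₂ (proj₁ freq r)
frequencySquare-row freq r false = proj₁ (proj₁ freq r)

frequencySquare-col : ∀ {h F} → IsFrequencySquare h F → ∀ c b → count (λ r → F r c == b) ≡ h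
frequencySquare-col freq c true  = proj₂ (proj₂ freq c)
frequencySquare-col freq c false = proj₁ (proj₂ freq c)

module HitCounts {λ′ k : ℕ} (F : Fin k → Square (2 * λ′)) (mofs : IsMOFS λ′ k F) (c : Fin k → Bool) where

  open CellSums (2 * λ′) (2 * λ′)

  agrees : Fin k → Fin (2 * λ′) → Fin (2 * λ′) → ℕ
  agrees m i j = ⟦ F m i j == c m ⟧

  agreements : Fin (2 * λ′) → Fin (2 * λ′) → ℕ
  agreements i j = sumFin (λ m → agrees m i j)

  agrees-row : ∀ m i → sumFin (agrees m i) ≡ λ′
  agrees-row m i =
    trans (sym (count≡sumFin (λ j → F m i j == c m))) (frequencySquare-row {F = F m} (proj₁ mofs m) i (c m))

  agrees-col : ∀ m j → sumFin (λ i → agrees m i j) ≡ λ′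
  agrees-col m j =
    trans (sym (count≡sumFin (λ i → F m i j == c m))) (frequencySquare-col {F = F m} (proj₁ mofs m) j (c m))

  agreements-row : ∀ i → sumFin (agreements i) ≡ k * λ′
  agreements-row i = trans (sumFin-swap (λ j m → agrees m i j)) (sumFin-const λ′ (λ m → agrees-row m i))

  agreements-col : ∀ j → sumFin (λ i → agreements i j) ≡ k * λ′
  agreements-col j = trans (sumFin-swap (λ i m → agrees m i j)) (sumFin-const λ′ (λ m → agrees-col m j))

  sumCells-agrees-pair : ∀ m m′ → m ≢ m′ → sumCells (λ i j → agrees m i j * agrees m′ i j) ≡ λ′ * λ′
  sumCells-agrees-pair m m′ m≢m′ = begin
    sumCells (λ i j → agrees m i j * agrees m′ i j)
      ≡⟨ sumCells-cong (λ i j → ⟦⟧-∧ (F m i j == c m) (F m′ i j == c m′)) ⟩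
    sumCells (λ i j → ⟦ (F m i j == c m) ∧ (F m′ i j == c m′) ⟧)
      ≡⟨ countCells≡sumCells (λ i j → (F m i j == c m) ∧ (F m′ i j == c m′)) ⟨
    countCells (λ i j → (F m i j == c m) ∧ (F m′ i j == c m′))
      ≡⟨ proj₂ mofs m m′ m≢m′ (c m) (c m′) ⟩
    λ′ * λ′ ∎

  sumCells-agrees-square : ∀ m → sumCells (λ i j → agrees m i j * agrees m i j) ≡ λ′ * λ′ + λ′ * λ′
  sumCells-agrees-square m = begin
    sumCells (λ i j → agrees m i j * agrees m i j) ≡⟨ sumCells-cong (λ i j → ⟦⟧-idem (F m i j == c m)) ⟩
    sumCells (agrees m)                            ≡⟨ sumFin-const λ′ (agrees-row m) ⟩
    2 * λ′ * λ′                                    ≡⟨ double λ′ ⟩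
    λ′ * λ′ + λ′ * λ′                              ∎
    where
    double : ∀ l → 2 * l * l ≡ l * l + l * l
    double = solve-∀

  sumCells-agreements² : sumCells (λ i j → agreements i j * agreements i j) ≡ k * (k * (λ′ * λ′) + λ′ * λ′)
  sumCells-agreements² = begin
    sumCells (λ i j → agreements i j * agreements i j)
      ≡⟨ sumCells-cong (λ i j → sumFin-*-sumFin (λ m → agrees m i j) (λ m → agrees m i j)) ⟩
    sumCells (λ i j → sumFin (λ m → sumFin (λ m′ → agrees m i j * agrees m′ i j)))
      ≡⟨ sumCells-sumFin-comm (λ i j m → sumFin (λ m′ → agrees m i j * agrees m′ i j)) ⟩
    sumFin (λ m → sumCells (λ i j → sumFin (λ m′ → agrees m i j * agrees m′ i j)))
      ≡⟨ sumFin-cong (λ m → sumCells-sumFin-comm (λ i j m′ → agrees m i j * agrees m′ i j)) ⟩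
    sumFin (λ m → sumFin (λ m′ → sumCells (λ i j → agrees m i j * agrees m′ i j)))
      ≡⟨ sumFin-const _ (λ m → sumFin-const-except m (sumCells-agrees-pair m) (sumCells-agrees-square m)) ⟩
    k * (k * (λ′ * λ′) + λ′ * λ′) ∎

  module _ (x y : Fin (2 * λ′) → Bool) where

    hit : Fin (2 * λ′) → Fin (2 * λ′) → ℕ
    hit i j = ⟦ x i ⟧ + ⟦ y j ⟧ + agreements i j

    sumCells-hitMoment : sumCells (λ i j → hit i j * hit i j + 6 * hit i j) ≡ hitMoment (count x) (count y) k λ′
    sumCells-hitMoment =
      trans (sumCells-cong (λ i j → hit-square (x i) (y j) (agreements i j)))
        (trans (sumCells-+-≡ (sumCells-+-≡ (sumCells-+-≡ (sumCells-+-≡ (sumCells-+-≡ (sumCells-+-≡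
                  (sumCells-*-≡ 7 sum-x) (sumCells-*-≡ 7 sum-y)) (sumCells-*-≡ 2 sum-xy))
                  (sumCells-*-≡ 2 sum-xs)) (sumCells-*-≡ 2 sum-ys)) sumCells-agreements²)
                  (sumCells-*-≡ 6 sum-s))
               (closedForm (count x) (count y) k λ′))
      where
      sum-x : sumCells (λ i j → ⟦ x i ⟧) ≡ 2 * λ′ * count x
      sum-x = trans (sumFin-cong (λ i → sumFin-const {2 * λ′} ⟦ x i ⟧ (λ _ → refl)))
                    (trans (sumFin-*ˡ (2 * λ′) (λ i → ⟦ x i ⟧)) (cong (2 * λ′ *_) (sym (count≡sumFin x))))
      sum-y : sumCells (λ i j → ⟦ y j ⟧) ≡ 2 * λ′ * count y
      sum-y = sumFin-const {2 * λ′} (count y) (λ i → sym (count≡sumFin y))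
      sum-xy : sumCells (λ i j → ⟦ x i ⟧ * ⟦ y j ⟧) ≡ count x * count y
      sum-xy = sumCells-rowWeighted x (λ i → sym (count≡sumFin y))
      sum-xs : sumCells (λ i j → ⟦ x i ⟧ * agreements i j) ≡ count x * (k * λ′)
      sum-xs = sumCells-rowWeighted x agreements-row
      sum-ys : sumCells (λ i j → ⟦ y j ⟧ * agreements i j) ≡ count y * (k * λ′)
      sum-ys = sumCells-colWeighted y agreements-col
      sum-s : sumCells agreements ≡ 2 * λ′ * (k * λ′)
      sum-s = sumFin-const (k * λ′) agreements-row
      closedForm : ∀ A B k l →
        7 * (2 * l * A) + 7 * (2 * l * B) + 2 * (A * B) + 2 * (A * (k * l)) + 2 * (B * (k * l))
          + k * (k * (l * l) + l * l) + 6 * (2 * l * (k * l))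
        ≡ 2 * l * (k + 7) * (A + B) + 2 * (A * B) + k * (k + 13) * (l * l)
      closedForm = solve-∀

    sumFin-hit-row : ∀ i → sumFin (hit i) ≡ 2 * λ′ * ⟦ x i ⟧ + (count y + k * λ′)
    sumFin-hit-row i = begin
      sumFin (hit i)
        ≡⟨ sumFin-+ (λ j → ⟦ x i ⟧ + ⟦ y j ⟧) (agreements i) ⟩
      sumFin (λ j → ⟦ x i ⟧ + ⟦ y j ⟧) + sumFin (agreements i)
        ≡⟨ cong₂ _+_ (sumFin-+ (λ _ → ⟦ x i ⟧) (λ j → ⟦ y j ⟧)) (agreements-row i) ⟩
      sumFin {2 * λ′} (λ _ → ⟦ x i ⟧) + sumFin (λ j → ⟦ y j ⟧) + k * λ′
        ≡⟨ cong (_+ k * λ′) (cong₂ _+_ (sumFin-const {2 * λ′} ⟦ x i ⟧ (λ _ → refl)) (sym (count≡sumFin y))) ⟩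
      2 * λ′ * ⟦ x i ⟧ + count y + k * λ′
        ≡⟨ +-assoc (2 * λ′ * ⟦ x i ⟧) (count y) (k * λ′) ⟩
      2 * λ′ * ⟦ x i ⟧ + (count y + k * λ′) ∎

    sumFin-hit-col : ∀ j → sumFin (λ i → hit i j) ≡ 2 * λ′ * ⟦ y j ⟧ + (count x + k * λ′)
    sumFin-hit-col j = begin
      sumFin (λ i → hit i j)
        ≡⟨ sumFin-+ (λ i → ⟦ x i ⟧ + ⟦ y j ⟧) (λ i → agreements i j) ⟩
      sumFin (λ i → ⟦ x i ⟧ + ⟦ y j ⟧) + sumFin (λ i → agreements i j)
        ≡⟨ cong₂ _+_ (sumFin-+ (λ i → ⟦ x i ⟧) (λ _ → ⟦ y j ⟧)) (agreements-col j) ⟩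
      sumFin (λ i → ⟦ x i ⟧) + sumFin {2 * λ′} (λ _ → ⟦ y j ⟧) + k * λ′
        ≡⟨ cong (_+ k * λ′) (cong₂ _+_ (sym (count≡sumFin x)) (sumFin-const {2 * λ′} ⟦ y j ⟧ (λ _ → refl))) ⟩
      count x + 2 * λ′ * ⟦ y j ⟧ + k * λ′
        ≡⟨ xy∙z≈y∙xz (count x) (2 * λ′ * ⟦ y j ⟧) (k * λ′) ⟩
      2 * λ′ * ⟦ y j ⟧ + (count x + k * λ′) ∎

nonTrivial⇒singleton : ∀ {P : Bool → Bool} (nt : NonTrivial P) → ∀ b → P b ≡ (b == proj₁ (proj₁ nt))
nonTrivial⇒singleton ((true  , Pt≡t) , (false , Pf≡f)) true  = Pt≡t
nonTrivial⇒singleton ((true  , Pt≡t) , (false , Pf≡f)) false = Pf≡f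
nonTrivial⇒singleton ((false , Pf≡t) , (true  , Pt≡f)) true  = Pt≡f
nonTrivial⇒singleton ((false , Pf≡t) , (true  , Pt≡f)) false = Pf≡t
nonTrivial⇒singleton ((true  , Pt≡t) , (true  , Pt≡f)) b     = contradiction (trans (sym Pt≡t) Pt≡f) λ ()
nonTrivial⇒singleton ((false , Pf≡t) , (false , Pf≡f)) b     = contradiction (trans (sym Pf≡t) Pf≡f) λ ()

nonTrivial-not : ∀ {P : Bool → Bool} → NonTrivial P → NonTrivial (not ∘ P)
nonTrivial-not ((t , Pt≡true) , (f , Pf≡false)) = (f , cong not Pf≡false) , (t , cong not Pt≡true)

complement : ∀ {n k} → Relation n (suc k) → Relation n (suc k)
complement (relation X₁ X₂ X) = relation (not ∘ X₁) X₂ λ { zero → not ∘ X zero ; (suc m) → X (suc m) }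

complement-nonTrivial : ∀ {n k} {R : Relation n (suc k)} →
  (∀ m → NonTrivial (Relation.X R m)) → ∀ m → NonTrivial (Relation.X (complement R) m)
complement-nonTrivial nonTrivial zero    = nonTrivial-not (nonTrivial zero)
complement-nonTrivial nonTrivial (suc m) = nonTrivial (suc m)

not-pair-parity : ∀ u w a b → (⟦ not u ⟧ + a + (⟦ not w ⟧ + b)) % 2 ≡ (⟦ u ⟧ + a + (⟦ w ⟧ + b)) % 2
not-pair-parity true  true  a b = sym (trans (cong (_% 2) (twoMore a b)) ([m+kn]%n≡m%n (a + b) 1 2))
  where
  twoMore : ∀ a b → 1 + a + (1 + b) ≡ a + b + 1 * 2
  twoMore = solve-∀
not-pair-parity true  false a b = cong (_% 2) (+-suc a b)
not-pair-parity false true  a b = cong (_% 2) (sym (+-suc a b))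
not-pair-parity false false a b = sym (not-pair-parity true true a b)

complement-satisfies : ∀ {n k} {F : Fin (suc k) → Square n} {R : Relation n (suc k)} →
  Satisfies F R → Satisfies F (complement R)
complement-satisfies {F = F} {relation X₁ X₂ X} sat i j =
  trans (not-pair-parity (X₁ i) (X zero (F zero i j)) ⟦ X₂ j ⟧ (sumFin (λ m → ⟦ X (suc m) (F (suc m) i j) ⟧)))
        (sat i j)

module Satisfied {λ′ k : ℕ} (F : Fin k → Square (2 * λ′)) (mofs : IsMOFS λ′ k F)
                 (R : Relation (2 * λ′) k) (nonTrivial : ∀ m → NonTrivial (Relation.X R m))
                 (sat : Satisfies F R) where

  open Relation R
  open HitCounts F mofs (λ m → proj₁ (proj₁ (nonTrivial m)))

  hits≡hit : ∀ i j → hits F R i j ≡ hit X₁ X₂ i j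
  hits≡hit i j =
    cong (⟦ X₁ i ⟧ + ⟦ X₂ j ⟧ +_) (sumFin-cong (λ m → cong ⟦_⟧ (nonTrivial⇒singleton (nonTrivial m) (F m i j))))

  2∣hit : ∀ i j → 2 ∣ hit X₁ X₂ i j
  2∣hit i j = m%n≡0⇒n∣m _ 2 (trans (cong (_% 2) (sym (hits≡hit i j))) (sat i j))

  8∣hitMoment : 8 ∣ hitMoment (count X₁) (count X₂) k λ′
  8∣hitMoment = subst (8 ∣_) (sumCells-hitMoment X₁ X₂)
    (sumFin-∣ (λ i → sumFin-∣ (λ j → 2∣n⇒8∣n*n+6*n (2∣hit i j))))

  2∣count₂+kλ : Fin (2 * λ′) → 2 ∣ count X₂ + k * λ′
  2∣count₂+kλ i = ∣m+n∣m⇒∣n (subst (2 ∣_) (sumFin-hit-row X₁ X₂ i) (sumFin-∣ (2∣hit i)))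
    (∣-trans (m∣m*n λ′) (m∣m*n ⟦ X₁ i ⟧))

  2∣count₁+kλ : Fin (2 * λ′) → 2 ∣ count X₁ + k * λ′
  2∣count₁+kλ j = ∣m+n∣m⇒∣n (subst (2 ∣_) (sumFin-hit-col X₁ X₂ j) (sumFin-∣ (λ i → 2∣hit i j)))
    (∣-trans (m∣m*n λ′) (m∣m*n ⟦ X₂ j ⟧))

theorem2p4 : (λ′ k : ℕ) → λ′ % 2 ≡ 1 → 0 < k → k % 4 ≢ 1 →
    (F : Fin k → Square (2 * λ′)) → IsMOFS λ′ k F →
    ¬ (Σ (Relation (2 * λ′) k) (λ R → Satisfies F R × Full R))
theorem2p4 zero k () _ _ _ _ _
theorem2p4 λ′@(suc _) zero _ () _ _ _ _
theorem2p4 λ′@(suc _) k@(suc _) λ′-odd _ k≢1 F mofs (R , sat , nonTrivial , _) =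
  ¬HitConditions (count X₁) (count (not ∘ X₁)) (count X₂) k λ′
    (λ′-odd , k≢1 , S.2∣count₁+kλ zero , S.2∣count₂+kλ zero , ≡⇒≈ (count+count-not X₁) ,
     S.8∣hitMoment , S′.8∣hitMoment)
  where
  open Relation R
  module S  = Satisfied F mofs R nonTrivial sat
  module S′ = Satisfied F mofs (complement R) (complement-nonTrivial {R = R} nonTrivial)
    (complement-satisfies {F = F} {R} sat)
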